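{- Let $Ag$ be a finite set of agents and $\mathcal{CS}$ a constant specification. Whenever $(\Gamma_1,\dots,\Gamma_n)$ is an element, there exists $\Gamma_{n+1}\subseteq Form^{Ag}$ such that $(\Gamma_1,\dots,\Gamma_n,\Gamma_{n+1})$ is also an element.
   Context: Language: finite $Ag$; countably infinite $PVar$, $PConst$, $Var$; $Pol$: $t ::= x\mid c\mid s+t\mid s\times t\mid\ !t$; $Form^{Ag}$: $A ::= p\mid A\wedge B\mid\neg A\mid[j]A\mid\Box A\mid t{:}A\mid KA\mid Prove(j,t,A)\mid Proven(t,A)$; $\Diamond$, $\langle j\rangle$ duals. System $\Pi$: axiom schemes (A0) propositional tautologies; (A1) S5 for $\Box$ and each $[j]$; (A2) $\Box A\to[j]A$; (A3) $(\Diamond[j_1]A_1\wedge\dots\wedge\Diamond[j_n]A_n)\to\Diamond([j_1]A_1\wedge\dots\wedge[j_n]A_n)$, $j_k$ pairwise distinct; (A4) $s{:}(A\to B)\to(t{:}A\to(s\times t){:}B)$; (A5) $t{:}A\to(!t{:}(t{:}A)\wedge KA)$; (A6) $(s{:}A\vee t{:}A)\to(s+t){:}A$; (A7) S4 for $K$; (A8) $KA\to\Box K\Box A$; (B9) $Prove(j,t,A)\to(\neg Proven(t,A)\wedge[j]Prove(j,t,A)\wedge\neg\Box Prove(j,t,A)\wedge t{:}A)$; (B10) $(Prove(j,t,A)\wedge t{:}B)\to Prove(j,t,B)$; (B11) $Proven(t,A)\to(KProven(t,A)\wedge t{:}A)$; (B12) $(Proven(t,A)\wedge t{:}B)\to Proven(t,B)$;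 (B13) $\neg Prove(j,t,A)\to\langle j\rangle\bigwedge_{i\in Ag}\neg Prove(i,t,A)$. Rules: modus ponens; from $A$ infer $KA$; (S4) from $KA\to(\neg Proven(t_1,B_1)\vee\dots\vee\neg Proven(t_n,B_n))$ infer $KA\to(\bigwedge_{j\in Ag}\neg Prove(j,t_1,B_1)\vee\dots\vee\bigwedge_{j\in Ag}\neg Prove(j,t_n,B_n))$. A constant specification $\mathcal{CS}$ is a set of formulas $c_n{:}\dots c_1{:}A$ ($c_i\in PConst$, $A$ an axiom instance) closed under removing the outermost constant; $\Pi(\mathcal{CS})$ adds the rule inferring members of $\mathcal{CS}$; $\vdash_{\mathcal{CS}}$ is provability in $\Pi(\mathcal{CS})$. $\Gamma$ is $\mathcal{CS}$-consistent iff no finite conjunction of its members implies $\bot$ provably in $\Pi(\mathcal{CS})$; $\mathcal{CS}$-maxiconsistent iff $\mathcal{CS}$-consistent with no proper $\mathcal{CS}$-consistent extension. An element is a finite sequence $(\Gamma_1,\dots,\Gamma_n)$, $n\geq1$, such that each $\Gamma_k$ is a $\mathcal{CS}$-maxiconsistent subset of $Form^{Ag}$, and for every $k<n$: $KA\in\Gamma_k$ implies $KA\in\Gamma_{k+1}$ for all $A$; and $Prove(j,t,A)\in\Gamma_k$ implies $Proven(t,A)\in\Gamma_{k+1}$ for all $t\in Pol$, $A\in Form^{Ag}$, $j\in Ag$. -}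

module Defs where

open import Data.Nat using (ℕ; zero; suc; _≤_)
open import Data.Fin using (Fin)
open import Data.Bool using (Bool; true; false; _∧_; not)
open import Data.List using (List; []; _∷_; map; allFin; length; _∷ʳ_)
open import Data.List.Relation.Unary.All using (All)
open import Data.List.Relation.Unary.Linked using (Linked)
open import Data.List.Relation.Unary.Unique.Propositional using (Unique)
open import Data.Product using (Σ; _×_; _,_; proj₁; proj₂)
open import Relation.Binary.PropositionalEquality using (_≡_)
open import Relation.Nullary using (¬_)

-- Agents: Ag = Fin m (an arbitrary finite set).
-- PVar, PConst, Var: all indexed by ℕ (countably infinite).

infixl 6 _⊕_
infixl 7 _⊗_
data Pol : Set where
  var : ℕ → Pol
  cst : ℕ → Pol
  _⊕_ : Pol → Pol → Pol
  _⊗_ : Pol → Pol → Pol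
  !_  : Pol → Pol

infixr 5 _∧'_
infix 8 ~_
data Form (m : ℕ) : Set where
  patom  : ℕ → Form m
  _∧'_   : Form m → Form m → Form m
  ~_     : Form m → Form m
  [_]_   : Fin m → Form m → Form m
  □_     : Form m → Form m
  _∶_    : Pol → Form m → Form m
  K_     : Form m → Form m
  Prove  : Fin m → Pol → Form m → Form m
  Proven : Pol → Form m → Form m

module _ {m : ℕ} where
  infixr 4 _⇒_
  infixr 5 _∨'_

  _⇒_ : Form m → Form m → Form m
  A ⇒ B = ~ (A ∧' ~ B)

  _∨'_ : Form m → Form m → Form m
  A ∨' B = ~ (~ A ∧' ~ B)

  ◇_ : Form m → Form m
  ◇ A = ~ (□ (~ A))

  ⟨_⟩_ : Fin m → Form m → Form m
  ⟨ j ⟩ A = ~ ([ j ] (~ A))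

  ⊥' : Form m
  ⊥' = patom 0 ∧' ~ patom 0

  ⊤' : Form m
  ⊤' = ~ ⊥'

  conjL : List (Form m) → Form m
  conjL []       = ⊤'
  conjL (A ∷ As) = A ∧' conjL As

  bigAnd : Form m → List (Form m) → Form m
  bigAnd A []       = A
  bigAnd A (B ∷ Bs) = A ∧' bigAnd B Bs

  bigOr : Form m → List (Form m) → Form m
  bigOr A []       = A
  bigOr A (B ∷ Bs) = A ∨' bigOr B Bs

  noneProve : Pol → Form m → Form m
  noneProve t A = conjL (map (λ i → ~ Prove i t A) (allFin m))

  -- propositional evaluation: all non-Boolean formulas are atoms
  eval : (Form m → Bool) → Form m → Bool
  eval v (A ∧' B) = eval v A ∧ eval v B
  eval v (~ A)    = not (eval v A)
  eval v A        = v A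

  Tautology : Form m → Set
  Tautology A = (v : Form m → Bool) → eval v A ≡ true

  dia-box : Fin m × Form m → Form m
  dia-box (j , A) = ◇ ([ j ] A)

  box-j : Fin m × Form m → Form m
  box-j (j , A) = [ j ] A

  data Axiom : Form m → Set where
    A0   : ∀ {A} → Tautology A → Axiom A
    A1□K : ∀ {A B} → Axiom (□ (A ⇒ B) ⇒ (□ A ⇒ □ B))
    A1□T : ∀ {A} → Axiom (□ A ⇒ A)
    A1□5 : ∀ {A} → Axiom (◇ A ⇒ □ (◇ A))
    A1jK : ∀ {j A B} → Axiom ([ j ] (A ⇒ B) ⇒ ([ j ] A ⇒ [ j ] B))
    A1jT : ∀ {j A} → Axiom ([ j ] A ⇒ A)
    A1j5 : ∀ {j A} → Axiom (⟨ j ⟩ A ⇒ [ j ] (⟨ j ⟩ A))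
    A2   : ∀ {j A} → Axiom (□ A ⇒ [ j ] A)
    A3   : (x : Fin m × Form m) (xs : List (Fin m × Form m)) →
           Unique (map proj₁ (x ∷ xs)) →
           Axiom (bigAnd (dia-box x) (map dia-box xs) ⇒
                  ◇ (bigAnd (box-j x) (map box-j xs)))
    A4   : ∀ {s t A B} → Axiom (s ∶ (A ⇒ B) ⇒ (t ∶ A ⇒ (s ⊗ t) ∶ B))
    A5   : ∀ {t A} → Axiom (t ∶ A ⇒ ((! t) ∶ (t ∶ A) ∧' K A))
    A6   : ∀ {s t A} → Axiom ((s ∶ A ∨' t ∶ A) ⇒ (s ⊕ t) ∶ A)
    A7K  : ∀ {A B} → Axiom (K (A ⇒ B) ⇒ (K A ⇒ K B))
    A7T  : ∀ {A} → Axiom (K A ⇒ A)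
    A74  : ∀ {A} → Axiom (K A ⇒ K (K A))
    A8   : ∀ {A} → Axiom (K A ⇒ □ (K (□ A)))
    B9   : ∀ {j t A} → Axiom (Prove j t A ⇒
             (~ Proven t A ∧' ([ j ] Prove j t A ∧' (~ □ Prove j t A ∧' t ∶ A))))
    B10  : ∀ {j t A B} → Axiom ((Prove j t A ∧' t ∶ B) ⇒ Prove j t B)
    B11  : ∀ {t A} → Axiom (Proven t A ⇒ (K Proven t A ∧' t ∶ A))
    B12  : ∀ {t A B} → Axiom ((Proven t A ∧' t ∶ B) ⇒ Proven t B)
    B13  : ∀ {j t A} → Axiom (~ Prove j t A ⇒ ⟨ j ⟩ noneProve t A)

  notProven : Pol × Form m → Form m
  notProven (t , B) = ~ Proven t B

  noneProve' : Pol × Form m → Form m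
  noneProve' (t , B) = noneProve t B

  data CChain : Form m → Set where
    base : ∀ {A} (c : ℕ) → Axiom A → CChain (cst c ∶ A)
    step : ∀ {B} (c : ℕ) → CChain B → CChain (cst c ∶ B)

  IsCS : (Form m → Set) → Set
  IsCS CS = (∀ A → CS A → CChain A) ×
            (∀ c B → CS (cst c ∶ B) → CChain B → CS B)

  data _⊢_ (CS : Form m → Set) : Form m → Set where
    ax   : ∀ {A} → Axiom A → CS ⊢ A
    mp   : ∀ {A B} → CS ⊢ (A ⇒ B) → CS ⊢ A → CS ⊢ B
    necK : ∀ {A} → CS ⊢ A → CS ⊢ (K A)
    ruleS4 : ∀ {A} (x : Pol × Form m) (xs : List (Pol × Form m)) →
             CS ⊢ (K A ⇒ bigOr (notProven x) (map notProven xs)) →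
             CS ⊢ (K A ⇒ bigOr (noneProve' x) (map noneProve' xs))
    csR  : ∀ {A} → CS A → CS ⊢ A

  Consistent : (Form m → Set) → (Form m → Set) → Set
  Consistent CS Γ =
    ¬ (Σ (List (Form m)) λ Δ → All Γ Δ × (CS ⊢ (conjL Δ ⇒ ⊥')))

  MaxiConsistent : (Form m → Set) → (Form m → Set) → Set₁
  MaxiConsistent CS Γ =
    Consistent CS Γ ×
    ((Δ : Form m → Set) → (∀ A → Γ A → Δ A) → Consistent CS Δ →
      ¬ (Σ (Form m) λ A → Δ A × ¬ Γ A))

  Succ : (Form m → Set) → (Form m → Set) → Set
  Succ Γ Δ = (∀ A → Γ (K A) → Δ (K A)) ×
             (∀ j t A → Γ (Prove j t A) → Δ (Proven t A))

  IsElement : (Form m → Set) → List (Form m → Set) → Set₁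
  IsElement CS Γs = (1 ≤ length Γs) × All (MaxiConsistent CS) Γs × Linked Succ Γs

module Submission where

-- Let Γ = Γₙ. A successor of Γ must contain the set Required of all K B with
-- K B ∈ Γ and all Proven(t,B) with Prove(j,t,B) ∈ Γ for some agent j.  The
-- mathematical core is that Required is CS-consistent: a finite inconsistent
-- part of it reduces to a refutation ⊢ K X → ¬(Proven(t₁,B₁) ∧ … ∧ Proven(tₖ,Bₖ))
-- with K X derivable from Γ; for k = 0 this makes Γ inconsistent, and for k > 0
-- rule (S4) turns it into ⊢ K X → ⋁ᵢ ⋀_j ¬Prove(j,tᵢ,Bᵢ), again contradicting Γ.
-- A Lindenbaum construction then extends Required to a maximally consistent set.

open import Defs
open import Data.Nat using (ℕ; zero; suc; _≤′_; ≤′-refl; ≤′-step; _⊔_; z≤n; s≤s)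
open import Data.Nat.Properties using (≤⇒≤′; m≤m⊔n; m≤n⊔m)
open import Data.Nat.Binary using (ℕᵇ; zero; 2[1+_]; 1+[2_]; toℕ)
open import Data.Nat.Binary.Properties using (toℕ-injective)
open import Data.Fin using (Fin; zero; suc)
open import Data.Bool using (Bool; true; false; _∧_; not; T)
open import Data.Bool.Properties using (T-∧; T-≡; ∧-inverseʳ)
open import Data.Maybe using (Maybe; just; nothing; map; zipWith; ap)
open import Data.Maybe.Properties using (just-injective)
open import Data.Vec using (Vec; []; _∷_; lookup)
import Data.Vec as Vec
open import Data.Vec.Properties using (lookup-map)
open import Data.List using (List; []; _∷_; _++_; _∷ʳ_)
import Data.List as List
open import Data.List.Relation.Unary.All as All using (All; []; _∷_)
open import Data.List.Relation.Unary.All.Properties using (++⁺; ∷ʳ⁺)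
open import Data.List.Relation.Unary.Any using (here; there)
open import Data.List.Relation.Unary.Linked using (Linked; [-]; _∷_)
open import Data.List.Membership.Propositional using (_∈_)
open import Data.List.Membership.Propositional.Properties using (∈-map⁺; ∈-allFin)
open import Data.Product using (Σ; _×_; _,_; proj₁; proj₂)
open import Data.Sum using (_⊎_; inj₁; inj₂)
open import Function using (_∘_)
open import Function.Bundles using (Equivalence)
open import Relation.Binary.PropositionalEquality
  using (_≡_; refl; sym; trans; cong; cong₂; subst; module ≡-Reasoning)
open import Relation.Nullary using (¬_)

-- Formulas are countable.  They embed, via an explicit left inverse, into binary
-- trees with natural-number leaves, and trees embed into ℕ by a prefix-free
-- binary serialisation (the two successor constructors of ℕᵇ serve as bits).

infixr 5 _·_
data Tree : Set where
  leaf : ℕ → Tree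
  _·_  : Tree → Tree → Tree

dropBit : ℕᵇ → ℕᵇ
dropBit zero     = zero
dropBit 2[1+ x ] = x
dropBit 1+[2 x ] = x

serialiseℕ : ℕ → ℕᵇ → ℕᵇ
serialiseℕ zero    r = 1+[2 r ]
serialiseℕ (suc n) r = 2[1+ serialiseℕ n r ]

serialise : Tree → ℕᵇ → ℕᵇ
serialise (leaf n) r = 1+[2 serialiseℕ n r ]
serialise (s · t)  r = 2[1+ serialise s (serialise t r) ]

serialiseℕ-injective : ∀ a b {r q} → serialiseℕ a r ≡ serialiseℕ b q → a ≡ b × r ≡ q
serialiseℕ-injective zero    zero    eq = refl , cong dropBit eq
serialiseℕ-injective zero    (suc b) ()
serialiseℕ-injective (suc a) zero    ()
serialiseℕ-injective (suc a) (suc b) eq with serialiseℕ-injective a b (cong dropBit eq)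
... | refl , r≡q = refl , r≡q

serialise-injective : ∀ s t {r q} → serialise s r ≡ serialise t q → s ≡ t × r ≡ q
serialise-injective (leaf a) (leaf b)  eq with serialiseℕ-injective a b (cong dropBit eq)
... | refl , r≡q = refl , r≡q
serialise-injective (leaf a) (t · u)   ()
serialise-injective (s · u)  (leaf b)  ()
serialise-injective (s · u)  (s′ · u′) eq with serialise-injective s s′ (cong dropBit eq)
... | refl , rest with serialise-injective u u′ rest
...   | refl , r≡q = refl , r≡q

treeCode : Tree → ℕ
treeCode t = toℕ (serialise t zero)

treeCode-injective : ∀ {s t} → treeCode s ≡ treeCode t → s ≡ t
treeCode-injective {s} {t} eq = proj₁ (serialise-injective s t (toℕ-injective eq))

finTree : ∀ {n} → Fin n → Tree
finTree zero    = leaf 0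
finTree (suc i) = leaf 1 · finTree i

finOf : ∀ {n} → Tree → Maybe (Fin n)
finOf {suc n} (leaf 0)     = just zero
finOf {suc n} (leaf 1 · t) = map suc (finOf t)
finOf         _            = nothing

finOf-finTree : ∀ {n} (i : Fin n) → finOf (finTree i) ≡ just i
finOf-finTree zero    = refl
finOf-finTree (suc i) rewrite finOf-finTree i = refl

polTree : Pol → Tree
polTree (var x) = leaf 0 · leaf x
polTree (cst c) = leaf 1 · leaf c
polTree (s ⊕ t) = leaf 2 · polTree s · polTree t
polTree (s ⊗ t) = leaf 3 · polTree s · polTree t
polTree (! t)   = leaf 4 · polTree t

polOf : Tree → Maybe Pol
polOf (leaf 0 · leaf x) = just (var x)
polOf (leaf 1 · leaf c) = just (cst c)
polOf (leaf 2 · s · t)  = zipWith _⊕_ (polOf s) (polOf t)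
polOf (leaf 3 · s · t)  = zipWith _⊗_ (polOf s) (polOf t)
polOf (leaf 4 · t)      = map !_ (polOf t)
polOf _                 = nothing

polOf-polTree : ∀ t → polOf (polTree t) ≡ just t
polOf-polTree (var x) = refl
polOf-polTree (cst c) = refl
polOf-polTree (s ⊕ t) rewrite polOf-polTree s | polOf-polTree t = refl
polOf-polTree (s ⊗ t) rewrite polOf-polTree s | polOf-polTree t = refl
polOf-polTree (! t)   rewrite polOf-polTree t = refl

module _ {m : ℕ} where

  formTree : Form m → Tree
  formTree (patom n)     = leaf 0 · leaf n
  formTree (A ∧' B)      = leaf 1 · formTree A · formTree B
  formTree (~ A)         = leaf 2 · formTree A
  formTree ([ j ] A)     = leaf 3 · finTree j · formTree A
  formTree (□ A)         = leaf 4 · formTree A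
  formTree (t ∶ A)       = leaf 5 · polTree t · formTree A
  formTree (K A)         = leaf 6 · formTree A
  formTree (Prove j t A) = leaf 7 · finTree j · polTree t · formTree A
  formTree (Proven t A)  = leaf 8 · polTree t · formTree A

  formOf : Tree → Maybe (Form m)
  formOf (leaf 0 · leaf n)    = just (patom n)
  formOf (leaf 1 · a · b)     = zipWith _∧'_ (formOf a) (formOf b)
  formOf (leaf 2 · a)         = map ~_ (formOf a)
  formOf (leaf 3 · j · a)     = zipWith [_]_ (finOf j) (formOf a)
  formOf (leaf 4 · a)         = map □_ (formOf a)
  formOf (leaf 5 · t · a)     = zipWith _∶_ (polOf t) (formOf a)
  formOf (leaf 6 · a)         = map K_ (formOf a)
  formOf (leaf 7 · j · t · a) = ap (zipWith Prove (finOf j) (polOf t)) (formOf a)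
  formOf (leaf 8 · t · a)     = zipWith Proven (polOf t) (formOf a)
  formOf _                    = nothing

  formOf-formTree : ∀ A → formOf (formTree A) ≡ just A
  formOf-formTree (patom n)     = refl
  formOf-formTree (A ∧' B)      rewrite formOf-formTree A | formOf-formTree B = refl
  formOf-formTree (~ A)         rewrite formOf-formTree A = refl
  formOf-formTree ([ j ] A)     rewrite finOf-finTree j | formOf-formTree A = refl
  formOf-formTree (□ A)         rewrite formOf-formTree A = refl
  formOf-formTree (t ∶ A)       rewrite polOf-polTree t | formOf-formTree A = refl
  formOf-formTree (K A)         rewrite formOf-formTree A = refl
  formOf-formTree (Prove j t A)
    rewrite finOf-finTree j | polOf-polTree t | formOf-formTree A = refl
  formOf-formTree (Proven t A)  rewrite polOf-polTree t | formOf-formTree A = refl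

  code : Form m → ℕ
  code A = treeCode (formTree A)

  code-injective : ∀ {A B} → code A ≡ code B → A ≡ B
  code-injective {A} {B} eq = just-injective (begin
    just A              ≡⟨ formOf-formTree A ⟨
    formOf (formTree A) ≡⟨ cong formOf (treeCode-injective {formTree A} {formTree B} eq) ⟩
    formOf (formTree B) ≡⟨ formOf-formTree B ⟩
    just B              ∎)
    where open ≡-Reasoning

-- Consistency and maximality
-- are stated exactly as Consistent/MaxiConsistent in Defs, so the construction
-- needs no decision procedure: formula number k is added at stage k+1 precisely
-- when it is consistent to do so, and that condition is recorded as evidence.
module Lindenbaum {F : Set} (code : F → ℕ)
                  (code-injective : ∀ {A B} → code A ≡ code B → A ≡ B)
                  (Inconsistent : List F → Set) where

  FinitelyConsistent : (F → Set) → Set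
  FinitelyConsistent Γ = ¬ (Σ (List F) λ Δ → All Γ Δ × Inconsistent Δ)

  MaximallyConsistent : (F → Set) → Set₁
  MaximallyConsistent Γ =
    FinitelyConsistent Γ ×
    ((Δ : F → Set) → (∀ A → Γ A → Δ A) → FinitelyConsistent Δ →
      ¬ (Σ F λ A → Δ A × ¬ Γ A))

  old-or-certified : ∀ {P Q : F → Set} {C : Set} {Δ} →
                     All (λ A → P A ⊎ (Q A × C)) Δ → C ⊎ All P Δ
  old-or-certified []                  = inj₂ []
  old-or-certified (inj₂ (_ , c) ∷ _)  = inj₁ c
  old-or-certified (inj₁ p ∷ rest) with old-or-certified rest
  ... | inj₁ c  = inj₁ c
  ... | inj₂ ps = inj₂ (p ∷ ps)

  module Construction (B : F → Set) (B-consistent : FinitelyConsistent B) where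

    mutual
      stage : ℕ → F → Set
      stage zero      = B
      stage (suc k) A = stage k A ⊎ (code A ≡ k × FinitelyConsistent (candidate k))

      candidate : ℕ → F → Set
      candidate k A = stage k A ⊎ code A ≡ k

    limit : F → Set
    limit A = Σ ℕ λ k → stage k A

    base⊆limit : ∀ A → B A → limit A
    base⊆limit A A∈B = 0 , A∈B

    stage-mono : ∀ {k l A} → k ≤′ l → stage k A → stage l A
    stage-mono ≤′-refl      s = s
    stage-mono (≤′-step kl) s = inj₁ (stage-mono kl s)

    -- The stages form a chain, so a finite part of the limit lies in one stage.
    finite-in-stage : ∀ {Δ} → All limit Δ → Σ ℕ λ k → All (stage k) Δ
    finite-in-stage []               = 0 , []
    finite-in-stage ((k , s) ∷ rest) with finite-in-stage rest
    ... | l , ss = k ⊔ l , stage-mono (≤⇒≤′ (m≤m⊔n k l)) s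
                         ∷ All.map (stage-mono (≤⇒≤′ (m≤n⊔m k l))) ss

    stage⊆candidate : ∀ k {A} → stage (suc k) A → candidate k A
    stage⊆candidate k (inj₁ s)        = inj₁ s
    stage⊆candidate k (inj₂ (eq , _)) = inj₂ eq

    stage-consistent : ∀ k → FinitelyConsistent (stage k)
    stage-consistent zero = B-consistent
    stage-consistent (suc k) (Δ , Δ⊆stage , bad) with old-or-certified Δ⊆stage
    ... | inj₁ candidate-consistent =
      candidate-consistent (Δ , All.map (stage⊆candidate k) Δ⊆stage , bad)
    ... | inj₂ Δ⊆old = stage-consistent k (Δ , Δ⊆old , bad)

    limit-consistent : FinitelyConsistent limit
    limit-consistent (Δ , Δ⊆limit , bad) with finite-in-stage Δ⊆limit
    ... | k , Δ⊆stage = stage-consistent k (Δ , Δ⊆stage , bad)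

    -- Any Δ ⊇ limit containing A contains the candidate set at stage code A;
    -- this is where injectivity of the coding is used.
    candidate⊆ : ∀ {Δ : F → Set} {A} → (∀ C → limit C → Δ C) → Δ A →
                 ∀ {C} → candidate (code A) C → Δ C
    candidate⊆ {A = A} limit⊆Δ A∈Δ {C} (inj₁ s)  = limit⊆Δ C (code A , s)
    candidate⊆ {Δ = Δ} limit⊆Δ A∈Δ     (inj₂ eq) = subst Δ (sym (code-injective eq)) A∈Δ

    -- A formula consistent with the limit was added at stage code A + 1.
    limit-maximal : MaximallyConsistent limit
    limit-maximal = limit-consistent , λ Δ limit⊆Δ Δ-consistent (A , A∈Δ , A∉limit) →
      A∉limit (suc (code A) , inj₂ (refl , λ (Θ , Θ⊆candidate , bad) →
        Δ-consistent (Θ , All.map (candidate⊆ limit⊆Δ A∈Δ) Θ⊆candidate , bad)))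

-- Instances of valid schemata are tautologies, hence axioms (A0); this
-- discharges all purely propositional steps below.

infixr 4 _⇒ₛ_
infixr 5 _∨ₛ_
infixr 6 _∧ₛ_
infix 8 ¬ₛ_
data Schema (n : ℕ) : Set where
  ‵_   : Fin n → Schema n
  ⊥ₛ   : Schema n
  _∧ₛ_ : Schema n → Schema n → Schema n
  ¬ₛ_  : Schema n → Schema n

_⇒ₛ_ : ∀ {n} → Schema n → Schema n → Schema n
φ ⇒ₛ ψ = ¬ₛ (φ ∧ₛ ¬ₛ ψ)

_∨ₛ_ : ∀ {n} → Schema n → Schema n → Schema n
φ ∨ₛ ψ = ¬ₛ (¬ₛ φ ∧ₛ ¬ₛ ψ)

⊤ₛ : ∀ {n} → Schema n
⊤ₛ = ¬ₛ ⊥ₛ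

p₀ : ∀ {n} → Schema (suc n)
p₀ = ‵ zero

p₁ : ∀ {n} → Schema (suc (suc n))
p₁ = ‵ suc zero

p₂ : ∀ {n} → Schema (suc (suc (suc n)))
p₂ = ‵ suc (suc zero)

p₃ : ∀ {n} → Schema (suc (suc (suc (suc n))))
p₃ = ‵ suc (suc (suc zero))

p₄ : ∀ {n} → Schema (suc (suc (suc (suc (suc n)))))
p₄ = ‵ suc (suc (suc (suc zero)))

⟦_⟧ : ∀ {n} → Schema n → Vec Bool n → Bool
⟦ ‵ i ⟧    ρ = lookup ρ i
⟦ ⊥ₛ ⟧     ρ = false
⟦ φ ∧ₛ ψ ⟧ ρ = ⟦ φ ⟧ ρ ∧ ⟦ ψ ⟧ ρ
⟦ ¬ₛ φ ⟧   ρ = not (⟦ φ ⟧ ρ)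

everyValuation : ∀ n → (Vec Bool n → Bool) → Bool
everyValuation zero    f = f []
everyValuation (suc n) f = everyValuation n (f ∘ (true ∷_)) ∧ everyValuation n (f ∘ (false ∷_))

everyValuation-sound : ∀ n (f : Vec Bool n → Bool) → T (everyValuation n f) → ∀ ρ → T (f ρ)
everyValuation-sound zero    f ok []          = ok
everyValuation-sound (suc n) f ok (true ∷ ρ)  =
  everyValuation-sound n (f ∘ (true ∷_)) (proj₁ (Equivalence.to T-∧ ok)) ρ
everyValuation-sound (suc n) f ok (false ∷ ρ) =
  everyValuation-sound n (f ∘ (false ∷_)) (proj₂ (Equivalence.to T-∧ ok)) ρ

Valid : ∀ {n} → Schema n → Set
Valid {n} φ = T (everyValuation n ⟦ φ ⟧)

module _ {m : ℕ} where

  instantiate : ∀ {n} → Vec (Form m) n → Schema n → Form m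
  instantiate σ (‵ i)    = lookup σ i
  instantiate σ ⊥ₛ       = ⊥'
  instantiate σ (φ ∧ₛ ψ) = instantiate σ φ ∧' instantiate σ ψ
  instantiate σ (¬ₛ φ)   = ~ instantiate σ φ

  eval-instantiate : ∀ {n} (v : Form m → Bool) (σ : Vec (Form m) n) φ →
                     eval v (instantiate σ φ) ≡ ⟦ φ ⟧ (Vec.map (eval v) σ)
  eval-instantiate v σ (‵ i)    = sym (lookup-map i (eval v) σ)
  eval-instantiate v σ ⊥ₛ       = ∧-inverseʳ (v (patom 0))
  eval-instantiate v σ (φ ∧ₛ ψ) = cong₂ _∧_ (eval-instantiate v σ φ) (eval-instantiate v σ ψ)
  eval-instantiate v σ (¬ₛ φ)   = cong not (eval-instantiate v σ φ)

  instance-tautology : ∀ {n} (φ : Schema n) → Valid φ → (σ : Vec (Form m) n) →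
                       Tautology (instantiate σ φ)
  instance-tautology {n} φ valid σ v =
    trans (eval-instantiate v σ φ)
          (Equivalence.to T-≡ (everyValuation-sound n ⟦ φ ⟧ valid (Vec.map (eval v) σ)))

module Derivability {m : ℕ} (CS : Form m → Set) where

  taut : ∀ {n} (φ : Schema n) {valid : Valid φ} (σ : Vec (Form m) n) →
         CS ⊢ instantiate σ φ
  taut φ {valid} σ = ax (A0 (instance-tautology φ valid σ))

  mp₂ : ∀ {A B C} → CS ⊢ (A ⇒ B ⇒ C) → CS ⊢ A → CS ⊢ B → CS ⊢ C
  mp₂ d a b = mp (mp d a) b

  mp₃ : ∀ {A B C D} → CS ⊢ (A ⇒ B ⇒ C ⇒ D) → CS ⊢ A → CS ⊢ B → CS ⊢ C → CS ⊢ D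
  mp₃ d a b c = mp (mp₂ d a b) c

  ⊢-trans : ∀ {A B C} → CS ⊢ (A ⇒ B) → CS ⊢ (B ⇒ C) → CS ⊢ (A ⇒ C)
  ⊢-trans {A} {B} {C} =
    mp₂ (taut ((p₀ ⇒ₛ p₁) ⇒ₛ (p₁ ⇒ₛ p₂) ⇒ₛ p₀ ⇒ₛ p₂) (A ∷ B ∷ C ∷ []))

  K-mono : ∀ {A B} → CS ⊢ (A ⇒ B) → CS ⊢ (K A ⇒ K B)
  K-mono d = mp (ax A7K) (necK d)

  K-pair : ∀ {A B} → CS ⊢ (K A ⇒ K B ⇒ K (A ∧' B))
  K-pair {A} {B} = ⊢-trans (K-mono (taut (p₀ ⇒ₛ p₁ ⇒ₛ p₀ ∧ₛ p₁) (A ∷ B ∷ []))) (ax A7K)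

  conjL-++ : ∀ Δ₁ Δ₂ → CS ⊢ (conjL (Δ₁ ++ Δ₂) ⇒ conjL Δ₁ ∧' conjL Δ₂)
  conjL-++ []       Δ₂ = taut (p₀ ⇒ₛ ⊤ₛ ∧ₛ p₀) (conjL Δ₂ ∷ [])
  conjL-++ (A ∷ Δ₁) Δ₂ =
    mp (taut ((p₀ ⇒ₛ p₁ ∧ₛ p₂) ⇒ₛ p₃ ∧ₛ p₀ ⇒ₛ (p₃ ∧ₛ p₁) ∧ₛ p₂)
             (conjL (Δ₁ ++ Δ₂) ∷ conjL Δ₁ ∷ conjL Δ₂ ∷ A ∷ []))
       (conjL-++ Δ₁ Δ₂)

  conjL-∈ : ∀ {A Δ} → A ∈ Δ → CS ⊢ (conjL Δ ⇒ A)
  conjL-∈ {A} {_ ∷ Δ} (here refl) = taut (p₀ ∧ₛ p₁ ⇒ₛ p₀) (A ∷ conjL Δ ∷ [])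
  conjL-∈ {A} {B ∷ Δ} (there A∈Δ) =
    ⊢-trans (taut (p₀ ∧ₛ p₁ ⇒ₛ p₁) (B ∷ conjL Δ ∷ [])) (conjL-∈ A∈Δ)

  ¬conjL⇒bigOr¬ : ∀ {I : Set} (f : I → Form m) x xs →
                  CS ⊢ (~ conjL (List.map f (x ∷ xs)) ⇒
                        bigOr (~ f x) (List.map (λ y → ~ f y) xs))
  ¬conjL⇒bigOr¬ f x []       = taut (¬ₛ (p₀ ∧ₛ ⊤ₛ) ⇒ₛ ¬ₛ p₀) (f x ∷ [])
  ¬conjL⇒bigOr¬ f x (y ∷ ys) =
    mp (taut ((¬ₛ p₁ ⇒ₛ p₂) ⇒ₛ ¬ₛ (p₀ ∧ₛ p₁) ⇒ₛ ¬ₛ p₀ ∨ₛ p₂)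
             (f x ∷ conjL (List.map f (y ∷ ys)) ∷
              bigOr (~ f y) (List.map (λ z → ~ f z) ys) ∷ []))
       (¬conjL⇒bigOr¬ f y ys)

  -- Γ ⊩ A: some finite part of Γ implies A.  Consistent CS Γ is ¬ (Γ ⊩ ⊥').
  infix 3 _⊩_
  _⊩_ : (Form m → Set) → Form m → Set
  Γ ⊩ A = Σ (List (Form m)) λ Δ → All Γ Δ × CS ⊢ (conjL Δ ⇒ A)

  ⊩-assumption : ∀ {Γ A} → Γ A → Γ ⊩ A
  ⊩-assumption {A = A} A∈Γ = A ∷ [] , A∈Γ ∷ [] , taut (p₀ ∧ₛ ⊤ₛ ⇒ₛ p₀) (A ∷ [])

  ⊩-theorem : ∀ {Γ A} → CS ⊢ A → Γ ⊩ A
  ⊩-theorem {A = A} d = [] , [] , mp (taut (p₀ ⇒ₛ ⊤ₛ ⇒ₛ p₀) (A ∷ [])) d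

  ⊩-mp : ∀ {Γ A B} → CS ⊢ (A ⇒ B) → Γ ⊩ A → Γ ⊩ B
  ⊩-mp d (Δ , Δ⊆Γ , Δ⇒A) = Δ , Δ⊆Γ , ⊢-trans Δ⇒A d

  ⊩-mp₂ : ∀ {Γ A B C} → CS ⊢ (A ⇒ B ⇒ C) → Γ ⊩ A → Γ ⊩ B → Γ ⊩ C
  ⊩-mp₂ {A = A} {B} {C} d (Δ₁ , Δ₁⊆Γ , Δ₁⇒A) (Δ₂ , Δ₂⊆Γ , Δ₂⇒B) =
    Δ₁ ++ Δ₂ , ++⁺ Δ₁⊆Γ Δ₂⊆Γ ,
    ⊢-trans (conjL-++ Δ₁ Δ₂)
      (mp₃ (taut ((p₀ ⇒ₛ p₂) ⇒ₛ (p₁ ⇒ₛ p₃) ⇒ₛ (p₂ ⇒ₛ p₃ ⇒ₛ p₄) ⇒ₛ p₀ ∧ₛ p₁ ⇒ₛ p₄)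
                 (conjL Δ₁ ∷ conjL Δ₂ ∷ A ∷ B ∷ C ∷ []))
           Δ₁⇒A Δ₂⇒B d)

  ⊩-contradiction : ∀ {Γ A} → Γ ⊩ A → Γ ⊩ ~ A → Γ ⊩ ⊥'
  ⊩-contradiction {A = A} = ⊩-mp₂ (taut (p₀ ⇒ₛ ¬ₛ p₀ ⇒ₛ ⊥ₛ) (A ∷ []))

  ⊩-refute-bigOr : ∀ {Γ} {I : Set} (g : I → Form m) x xs →
                   All (λ y → Γ ⊩ ~ g y) (x ∷ xs) → Γ ⊩ ~ bigOr (g x) (List.map g xs)
  ⊩-refute-bigOr g x []       (refuted ∷ [])   = refuted
  ⊩-refute-bigOr g x (y ∷ ys) (refuted ∷ rest) =
    ⊩-mp₂ (taut (¬ₛ p₀ ⇒ₛ ¬ₛ p₁ ⇒ₛ ¬ₛ (p₀ ∨ₛ p₁)) (g x ∷ bigOr (g y) (List.map g ys) ∷ []))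
          refuted (⊩-refute-bigOr g y ys rest)

module Successor {m : ℕ} (CS : Form m → Set) (Γ : Form m → Set) where
  open Derivability CS

  data Required : Form m → Set where
    known  : ∀ {B} → Γ (K B) → Required (K B)
    proven : ∀ {j t B} → Γ (Prove j t B) → Required (Proven t B)

  Underway : Pol × Form m → Set
  Underway (t , B) = Σ (Fin m) λ j → Γ (Prove j t B)

  proven′ : Pol × Form m → Form m
  proven′ (t , B) = Proven t B

  record Reduct (Δ : List (Form m)) : Set where
    constructor reduct-by
    field
      X        : Form m
      proofs   : List (Pol × Form m)
      KX       : Γ ⊩ K X
      underway : All Underway proofs
      implies  : CS ⊢ (K X ∧' conjL (List.map proven′ proofs) ⇒ conjL Δ)

  reduct : ∀ {Δ} → All Required Δ → Reduct Δ
  reduct [] =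
    reduct-by ⊤' [] (⊩-theorem (necK (taut ⊤ₛ []))) [] (taut (p₀ ∧ₛ ⊤ₛ ⇒ₛ ⊤ₛ) (K ⊤' ∷ []))
  reduct {K B ∷ Δ} (known KB∈Γ ∷ rest) with reduct rest
  ... | reduct-by X Ps KX underway implies =
    reduct-by (B ∧' X) Ps (⊩-mp₂ K-pair (⊩-assumption KB∈Γ) KX) underway
      (mp₃ (taut ((p₀ ⇒ₛ p₁) ⇒ₛ (p₀ ⇒ₛ p₂) ⇒ₛ (p₂ ∧ₛ p₃ ⇒ₛ p₄) ⇒ₛ p₀ ∧ₛ p₃ ⇒ₛ p₁ ∧ₛ p₄)
                 (K (B ∧' X) ∷ K B ∷ K X ∷ conjL (List.map proven′ Ps) ∷ conjL Δ ∷ []))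
           (K-mono (taut (p₀ ∧ₛ p₁ ⇒ₛ p₀) (B ∷ X ∷ [])))
           (K-mono (taut (p₀ ∧ₛ p₁ ⇒ₛ p₁) (B ∷ X ∷ [])))
           implies)
  reduct {Proven t B ∷ Δ} (proven {j} Prove∈Γ ∷ rest) with reduct rest
  ... | reduct-by X Ps KX underway implies =
    reduct-by X ((t , B) ∷ Ps) KX ((j , Prove∈Γ) ∷ underway)
      (mp (taut ((p₀ ∧ₛ p₁ ⇒ₛ p₂) ⇒ₛ p₀ ∧ₛ (p₃ ∧ₛ p₁) ⇒ₛ p₃ ∧ₛ p₂)
                (K X ∷ conjL (List.map proven′ Ps) ∷ conjL Δ ∷ Proven t B ∷ []))
          implies)

  Prove⇒¬noneProve : ∀ j t B → CS ⊢ (Prove j t B ⇒ ~ noneProve t B)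
  Prove⇒¬noneProve j t B =
    mp (taut ((p₀ ⇒ₛ ¬ₛ p₁) ⇒ₛ p₁ ⇒ₛ ¬ₛ p₀) (noneProve t B ∷ Prove j t B ∷ []))
       (conjL-∈ (∈-map⁺ (λ i → ~ Prove i t B) (∈-allFin j)))

  -- The heart of the argument, via rule (S4): knowledge derivable from a
  -- consistent Γ cannot refute that the proofs under way in Γ get completed.
  knowledge-allows-completion : Consistent CS Γ → ∀ {X} Ps → All Underway Ps → Γ ⊩ K X →
                                ¬ (CS ⊢ (K X ⇒ ~ conjL (List.map proven′ Ps)))
  knowledge-allows-completion Γ-consistent [] _ KX KX⇒¬⊤ =
    Γ-consistent (⊩-mp (taut (¬ₛ ⊤ₛ ⇒ₛ ⊥ₛ) []) (⊩-mp KX⇒¬⊤ KX))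
  knowledge-allows-completion Γ-consistent {X} (x ∷ xs) underway KX KX⇒¬⋀ =
    Γ-consistent (⊩-contradiction (⊩-mp KX⇒someoneProves KX)
                                  (⊩-refute-bigOr noneProve' x xs (All.map refuted underway)))
    where
      KX⇒someoneProves : CS ⊢ (K X ⇒ bigOr (noneProve' x) (List.map noneProve' xs))
      KX⇒someoneProves = ruleS4 x xs (⊢-trans KX⇒¬⋀ (¬conjL⇒bigOr¬ proven′ x xs))

      refuted : ∀ {y} → Underway y → Γ ⊩ ~ noneProve' y
      refuted {t , B} (j , Prove∈Γ) = ⊩-mp (Prove⇒¬noneProve j t B) (⊩-assumption Prove∈Γ)

  Required-consistent : Consistent CS Γ → Consistent CS Required
  Required-consistent Γ-consistent (Δ , Δ⊆Required , Δ⇒⊥) with reduct Δ⊆Required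
  ... | reduct-by X Ps KX underway implies =
    knowledge-allows-completion Γ-consistent Ps underway KX
      (mp₂ (taut ((p₀ ∧ₛ p₁ ⇒ₛ p₂) ⇒ₛ (p₂ ⇒ₛ ⊥ₛ) ⇒ₛ p₀ ⇒ₛ ¬ₛ p₁)
                 (K X ∷ conjL (List.map proven′ Ps) ∷ conjL Δ ∷ []))
           implies Δ⇒⊥)

  Required-succ : ∀ {Γ′} → (∀ A → Required A → Γ′ A) → Succ Γ Γ′
  Required-succ Required⊆Γ′ =
    (λ A KA∈Γ → Required⊆Γ′ (K A) (known KA∈Γ)) ,
    (λ j t A Prove∈Γ → Required⊆Γ′ (Proven t A) (proven Prove∈Γ))

successor-exists : ∀ {m} (CS : Form m → Set) {Γ : Form m → Set} → MaxiConsistent CS Γ →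
                   Σ (Form m → Set) λ Γ′ → MaxiConsistent CS Γ′ × Succ Γ Γ′
successor-exists CS {Γ} (Γ-consistent , _) =
  limit , limit-maximal , Required-succ (λ A → base⊆limit A)
  where
    open Successor CS Γ
    open Lindenbaum code code-injective (λ Δ → CS ⊢ (conjL Δ ⇒ ⊥'))
    open Construction Required (Required-consistent Γ-consistent)

module _ {a} {A : Set a} where

  lastOf : A → List A → A
  lastOf x []       = x
  lastOf _ (y ∷ ys) = lastOf y ys

  All-lastOf : ∀ {p} {P : A → Set p} {x} xs → All P (x ∷ xs) → P (lastOf x xs)
  All-lastOf []       (px ∷ [])  = px
  All-lastOf (y ∷ ys) (_ ∷ pys) = All-lastOf ys pys

  Linked-snoc : ∀ {r} {R : A → A → Set r} {x y} xs →
                Linked R (x ∷ xs) → R (lastOf x xs) y → Linked R ((x ∷ xs) ∷ʳ y)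
  Linked-snoc []       _           r = r ∷ [-]
  Linked-snoc (z ∷ zs) (rxz ∷ rzs) r = rxz ∷ Linked-snoc zs rzs r

lemma5 : (m : ℕ) (CS : Form m → Set) → IsCS CS →
         (Γs : List (Form m → Set)) → IsElement CS Γs →
         Σ (Form m → Set) (λ Γ → IsElement CS (Γs ∷ʳ Γ))
lemma5 m CS _ []        (() , _)
lemma5 m CS _ (Γ₁ ∷ Γs) (_ , maximal , linked)
  with successor-exists CS (All-lastOf Γs maximal)
... | Γ′ , Γ′-maximal , succ =
  Γ′ , s≤s z≤n , ∷ʳ⁺ maximal Γ′-maximal , Linked-snoc Γs linked succ
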